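{- Let $p_0(x),p_1(x),\dots$ be a sequence of polynomials in $\mathbf{k}[x]$ with $p_1(x)=x$ and $p_n(x)$ of degree $n$. The sequence is of binomial type if and only if there exists an umbra $\mu$ such that for all $n\ge0$ \[ p_n(x)\simeq x(x+\mu_1)(x+\mu_1+\mu_2)\cdots(x+\mu_1+\cdots+\mu_{n-1}), \] where $\mu_1,\dots,\mu_{n-1}$ are distinct umbrae each exchangeable with $\mu$ (the product being $1$ for $n=0$).
   Context: Let $\mathbf{k}$ be a commutative ring containing $\mathbb{Q}$ and $\mathbf{F}=\mathbf{k}[x,y]$. A sequence $p_0(x),p_1(x),\dots$ with $\deg p_n=n$ is of binomial type if $p_k(x+y)=\sum_i\binom{k}{i}p_i(x)p_{k-i}(y)$ for all $k$. Umbrae are formal symbols; $\mathbf{F}[\mathcal{A}]$ is the polynomial ring in the umbrae, with an $\mathbf{F}$-linear evaluation map $\mathbf{E}:\mathbf{F}[\mathcal{A}]\to\mathbf{F}$ satisfying $\mathbf{E}[1]=1$ and $\mathbf{E}[MM']=\mathbf{E}[M]\mathbf{E}[M']$ for monomials with no umbra in common (so distinct umbrae behave as independent); every sequence $1,a_1,a_2,\dots$ in $\mathbf{F}$ is represented by infinitely many umbrae. Write $p\simeq q$ if $\mathbf{E}[p]=\mathbf{E}[q]$, and $\mu_i$ is exchangeable with $\mu$ if $\mathbf{E}[\mu_i^k]=\mathbf{E}[\mu^k]$ for all $k$. -}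

module Defs where

open import Level using (Level; _⊔_)
open import Algebra.Bundles using (CommutativeRing)
open import Algebra.Morphism.Structures using (module RingMorphisms)
import Algebra.Definitions.RawMonoid as RawMonoidDefs
open import Data.Nat as ℕ using (ℕ; zero; suc; _∸_; _≡ᵇ_)
open import Data.Nat.Combinatorics using (_C_)
open import Data.Fin as Fin using (Fin)
open import Data.List using (List; []; _∷_; _++_; map; concatMap; foldr; foldl; take; allFin; upTo)
open import Data.Bool using (if_then_else_)
open import Data.Product using (Σ; _×_; _,_)
open import Relation.Nullary using (¬_; does)
import Data.Rational.Properties as ℚP
open import Data.Rational using (ℚ)

module _ {c ℓ : Level} (R : CommutativeRing c ℓ) where
  open CommutativeRing R
  open RawMonoidDefs +-rawMonoid using () renaming (_×_ to _·ₙ_)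

  Containsℚ : Set (c ⊔ ℓ)
  Containsℚ = Σ (ℚ → Carrier) λ f →
    RingMorphisms.IsRingMonomorphism ℚP.+-*-rawRing rawRing f

  Σ< : ℕ → (ℕ → Carrier) → Carrier
  Σ< zero    f = 0#
  Σ< (suc n) f = Σ< n f + f n

  -- Polynomials in k[x]: coefficient lists (constant term first).
  Poly : Set c
  Poly = List Carrier

  coeff : Poly → ℕ → Carrier
  coeff []       _       = 0#
  coeff (a ∷ _)  zero    = a
  coeff (_ ∷ as) (suc j) = coeff as j

  _≈P_ : Poly → Poly → Set ℓ
  p ≈P q = ∀ j → coeff p j ≈ coeff q j

  HasDegree : ℕ → Poly → Set ℓ
  HasDegree n p = (∀ j → n ℕ.< j → coeff p j ≈ 0#) × ¬ (coeff p n ≈ 0#)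

  Xpoly : Poly
  Xpoly = 0# ∷ 1# ∷ []

  -- Polynomials in F = k[x,y], as coefficient functions
  -- (f a b = coefficient of x^a y^b).
  Poly2 : Set c
  Poly2 = ℕ → ℕ → Carrier

  _≈₂_ : Poly2 → Poly2 → Set ℓ
  f ≈₂ g = ∀ a b → f a b ≈ g a b

  _+₂_ : Poly2 → Poly2 → Poly2
  (f +₂ g) a b = f a b + g a b

  _*₂_ : Poly2 → Poly2 → Poly2
  (f *₂ g) a b = Σ< (suc a) λ i → Σ< (suc b) λ j → f i j * g (a ∸ i) (b ∸ j)

  _⋆₂_ : ℕ → Poly2 → Poly2
  (n ⋆₂ f) a b = n ·ₙ f a b

  const₂ : Carrier → Poly2
  const₂ r zero    zero    = r
  const₂ r _       _       = 0#

  X+Y : Poly2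
  X+Y 1 0 = 1#
  X+Y 0 1 = 1#
  X+Y _ _ = 0#

  inX : Poly → Poly2
  inX p a zero    = coeff p a
  inX p a (suc _) = 0#

  inY : Poly → Poly2
  inY p zero    b = coeff p b
  inY p (suc _) b = 0#

  atX+Y : Poly → Poly2
  atX+Y []       = const₂ 0#
  atX+Y (r ∷ rs) = const₂ r +₂ (X+Y *₂ atX+Y rs)

  Σ₂< : ℕ → (ℕ → Poly2) → Poly2
  Σ₂< n F a b = Σ< n λ i → F i a b

  BinomialType : (ℕ → Poly) → Set ℓ
  BinomialType p = ∀ k →
    atX+Y (p k) ≈₂ Σ₂< (suc k) (λ i → (k C i) ⋆₂ (inX (p i) *₂ inY (p (k ∸ i))))

  -- Umbral expressions: polynomials (over k) in x and m distinct
  -- umbrae u₀ … u_{m-1}.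
  data UExpr (m : ℕ) : Set c where
    X    : UExpr m
    U    : Fin m → UExpr m
    K    : Carrier → UExpr m
    _⊕_  : UExpr m → UExpr m → UExpr m
    _⊗_  : UExpr m → UExpr m → UExpr m

  -- a monomial  r · x^d · ∏_i u_i^(v i)
  Mono : ℕ → Set c
  Mono m = Carrier × ℕ × (Fin m → ℕ)

  mulMono : ∀ {m} → Mono m → Mono m → Mono m
  mulMono (r , d , v) (s , e , w) = (r * s , d ℕ.+ e , λ i → v i ℕ.+ w i)

  expand : ∀ {m} → UExpr m → List (Mono m)
  expand X       = (1# , 1 , λ _ → 0) ∷ []
  expand (U i)   = (1# , 0 , λ j → if does (i Fin.≟ j) then 1 else 0) ∷ []
  expand (K r)   = (r , 0 , λ _ → 0) ∷ []
  expand (e ⊕ f) = expand e ++ expand f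
  expand (e ⊗ f) = concatMap (λ s → map (mulMono s) (expand f)) (expand e)

  ∏Fin : ∀ m → (Fin m → Carrier) → Carrier
  ∏Fin zero    g = 1#
  ∏Fin (suc m) g = g Fin.zero * ∏Fin m (λ i → g (Fin.suc i))

  -- Evaluation E : all umbrae u_i are distinct and exchangeable with an
  -- umbra μ whose moments are  E[μ^k] = a k.  By linearity and
  -- independence of distinct umbrae,
  --   E[r x^d ∏ u_i^(v i)] = r x^d ∏ a (v i).
  -- Result: the coefficient function of the resulting polynomial in x.
  E : ∀ {m} → (ℕ → Carrier) → UExpr m → ℕ → Carrier
  E {m} a e k = foldr step 0# (expand e)
    where
    step : Mono m → Carrier → Carrier
    step (r , d , v) acc = (if d ≡ᵇ k then r * ∏Fin m (λ i → a (v i)) else 0#) + acc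

  -- x (x + μ₁)(x + μ₁ + μ₂) ⋯ (x + μ₁ + ⋯ + μ_{n-1}),
  -- with μ_{j+1} represented by the umbra of index j : Fin n
  -- (the umbra of index n-1 does not occur).  Empty product = 1.
  factor : (n j : ℕ) → UExpr n
  factor n j = foldl (λ acc i → acc ⊕ U i) X (take j (allFin n))

  risingUmbral : (n : ℕ) → UExpr n
  risingUmbral n = foldr _⊗_ (K 1#) (map (factor n) (upTo n))

{-# OPTIONS --safe #-}
module Submission where

-- Write P n j for the coefficient of xʲ in pₙ; binomial type is the coefficient identity
-- C(x+y,x) P n (x+y) = Σᵢ C(n,i) P i x P (n-i) y.  The umbral product for n + 1 is x times
-- the product for n under x ↦ x + μ₁, μᵢ ↦ μᵢ₊₁, so it evaluates to the sequence
-- p₀ = 1, pₙ₊₁(x) = x E[pₙ(x + μ)] with E[μᵏ] = a k.  Splitting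
-- pₙ₊₁(x + y) = x E[pₙ(x + y + μ)] + y E[pₙ(x + y + μ)] and applying the identity for pₙ
-- at (x + μ, y) and at (x, y + μ) shows that this sequence is of binomial type for every a.
-- Conversely, over a ring containing ℚ the identity at x = 1 expresses (j+1) P n (j+1)
-- through the columns ≤ j, so a binomial sequence is determined by its coefficients of
-- x⁰ and x¹.  The former are forced to be δₙ₀, and since the coefficient of x in pₙ₊₁ is
-- Σₖ aₖ P n k with P n n = 1, the moments aₖ can be solved for one at a time.

open import Level using (Level) renaming (_⊔_ to _⊔ˡ_)
open import Algebra.Bundles using (CommutativeRing)
open import Algebra.Morphism.Structures using (module RingMorphisms)
import Algebra.Properties.CommutativeSemigroup
open import Data.Bool using (true; false; if_then_else_; T)
open import Data.Empty using (⊥-elim)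
open import Data.Fin as Fin using (Fin)
open import Data.List using (List; []; _∷_; _++_; map; concatMap; foldr; foldl; take; allFin; upTo; applyUpTo)
import Data.List.Properties as List
open import Data.List.Relation.Unary.All as All using (All; []; _∷_)
import Data.List.Relation.Unary.All.Properties as All
open import Data.Nat as ℕ using (ℕ; zero; suc; _∸_; _<_; _≤_; z≤n; s≤s; _≡ᵇ_; _⊔_)
import Data.Nat.Properties as ℕ
open import Data.Nat.Combinatorics
  using (_C_; nCk+nC[k+1]≡[n+1]C[k+1]; nCk≡nC[n∸k]; k>n⇒nCk≡0; nCn≡1; nC1≡n)
open import Data.Product using (Σ; _×_; _,_; proj₁)
open import Data.Rational as ℚ using (ℚ; 0ℚ; 1ℚ; 1/_)
import Data.Rational.Properties as ℚ
open import Data.Vec.Functional using () renaming (_∷_ to _∷ᵥ_)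
open import Function using (_∘_)
open import Function.Bundles using (_⇔_; mk⇔; Equivalence)
open import Relation.Binary.PropositionalEquality as ≡ using (_≡_; _≢_)
open import Relation.Nullary using (yes; no)

open import Defs

module BinomialCoefficients where
  open import Data.Nat
  open import Data.Nat.Properties
  open import Data.Nat.DivMod using (m/n*n≡m)
  open import Data.Nat.Combinatorics using (nCk≡n!/k![n-k]!; k![n∸k]!∣n!)
  open import Data.Nat.Tactic.RingSolver using (solve-∀)
  open ≡ using (cong; subst)
  open ≡.≡-Reasoning

  C-factorial : ∀ {n k} → k ≤ n → (n C k) * (k ! * (n ∸ k) !) ≡ n !
  C-factorial {n} {k} k≤n = begin
    (n C k) * (k ! * (n ∸ k) !)                     ≡⟨ cong (_* (k ! * (n ∸ k) !)) (nCk≡n!/k![n-k]! k≤n) ⟩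
    (n ! / (k ! * (n ∸ k) !)) * (k ! * (n ∸ k) !)   ≡⟨ m/n*n≡m (k![n∸k]!∣n! k≤n) ⟩
    n !                                             ∎
    where instance _ = k !* (n ∸ k) !≢0

  C+-factorial : ∀ a b → ((a + b) C a) * (a ! * b !) ≡ (a + b) !
  C+-factorial a b =
    subst (λ t → ((a + b) C a) * (a ! * t !) ≡ (a + b) !) (m+n∸m≡n a b) (C-factorial (m≤m+n a b))

  C+-comm : ∀ a b → (a + b) C a ≡ (b + a) C b
  C+-comm a b = *-cancelʳ-≡ _ _ (a ! * b !) (begin
    ((a + b) C a) * (a ! * b !)   ≡⟨ C+-factorial a b ⟩
    (a + b) !                     ≡⟨ cong _! (+-comm a b) ⟩
    (b + a) !                     ≡⟨ C+-factorial b a ⟨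
    ((b + a) C b) * (b ! * a !)   ≡⟨ cong (((b + a) C b) *_) (*-comm (b !) (a !)) ⟩
    ((b + a) C b) * (a ! * b !)   ∎)
    where instance _ = a !* b !≢0

  C+-trinomial : ∀ a b c →
    ((a + b) C a) * ((a + b + c) C (a + b)) * (a ! * b ! * c !) ≡ (a + b + c) !
  C+-trinomial a b c = begin
    x * y * (a ! * b ! * c !)   ≡⟨ rearrange x y (a !) (b !) (c !) ⟩
    y * (x * (a ! * b !) * c !) ≡⟨ cong (λ t → y * (t * c !)) (C+-factorial a b) ⟩
    y * ((a + b) ! * c !)       ≡⟨ C+-factorial (a + b) c ⟩
    (a + b + c) !               ∎
    where
    x : ℕ
    x = (a + b) C a
    y : ℕ
    y = (a + b + c) C (a + b)
    rearrange : ∀ x y p q r → x * y * (p * q * r) ≡ y * (x * (p * q) * r)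
    rearrange = solve-∀

  C+-exchange : ∀ a b c →
    ((a + b) C a) * ((a + b + c) C (a + b)) ≡ ((a + c) C a) * ((a + c + b) C (a + c))
  C+-exchange a b c = *-cancelʳ-≡ _ _ (a ! * b ! * c !) (begin
    ((a + b) C a) * ((a + b + c) C (a + b)) * (a ! * b ! * c !) ≡⟨ C+-trinomial a b c ⟩
    (a + b + c) !                                               ≡⟨ cong _! (+-assoc a b c) ⟩
    (a + (b + c)) !                                             ≡⟨ cong (λ t → (a + t) !) (+-comm b c) ⟩
    (a + (c + b)) !                                             ≡⟨ cong _! (+-assoc a c b) ⟨
    (a + c + b) !                                               ≡⟨ C+-trinomial a c b ⟨
    ((a + c) C a) * ((a + c + b) C (a + c)) * (a ! * c ! * b !) ≡⟨ cong (((a + c) C a) * ((a + c + b) C (a + c)) *_)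
                                                                        (swap-last (a !) (c !) (b !)) ⟩
    ((a + c) C a) * ((a + c + b) C (a + c)) * (a ! * b ! * c !) ∎)
    where
    instance _ = m*n≢0 (a ! * b !) (c !) {{a !* b !≢0}} {{c !≢0}}
    swap-last : ∀ p q r → p * q * r ≡ p * r * q
    swap-last = solve-∀

open BinomialCoefficients using (C+-comm; C+-exchange)

ℕ→ℚ : ℕ → ℚ
ℕ→ℚ zero    = 0ℚ
ℕ→ℚ (suc n) = 1ℚ ℚ.+ ℕ→ℚ n

ℕ→ℚ-suc-positive : ∀ n → ℚ.Positive (ℕ→ℚ (suc n))
ℕ→ℚ-suc-positive zero    = _
ℕ→ℚ-suc-positive (suc n) = ℚ.pos+pos⇒pos 1ℚ (ℕ→ℚ (suc n)) {{ℕ→ℚ-suc-positive n}}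

≡ᵇ-refl : ∀ n → (n ≡ᵇ n) ≡ true
≡ᵇ-refl zero    = ≡.refl
≡ᵇ-refl (suc n) = ≡ᵇ-refl n

≡ᵇ-≢ : ∀ {m n} → m ≢ n → (m ≡ᵇ n) ≡ false
≡ᵇ-≢ {m} {n} m≢n with m ≡ᵇ n in m≡ᵇn
... | true  = ⊥-elim (m≢n (ℕ.≡ᵇ⇒≡ m n (≡.subst T (≡.sym m≡ᵇn) _)))
... | false = ≡.refl

module UmbralSyntax {c ℓ : Level} (R : CommutativeRing c ℓ) where
  open CommutativeRing R using (1#)
  open ≡.≡-Reasoning

  translate : ∀ {m} → UExpr R m → UExpr R (suc m)
  translate X       = X ⊕ U Fin.zero
  translate (U i)   = U (Fin.suc i)
  translate (K r)   = K r
  translate (e ⊕ f) = translate e ⊕ translate f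
  translate (e ⊗ f) = translate e ⊗ translate f

  degX : ∀ {m} → UExpr R m → ℕ
  degX X       = 1
  degX (U _)   = 0
  degX (K _)   = 0
  degX (e ⊕ f) = degX e ⊔ degX f
  degX (e ⊗ f) = degX e ℕ.+ degX f

  deg : ∀ {m} → Mono R m → ℕ
  deg (_ , d , _) = d

  expand-degX : ∀ {m} (e : UExpr R m) → All (λ s → deg s ≤ degX e) (expand R e)
  expand-degX X       = ℕ.≤-refl ∷ []
  expand-degX (U _)   = z≤n ∷ []
  expand-degX (K _)   = z≤n ∷ []
  expand-degX (e ⊕ f) = All.++⁺ (All.map (λ d≤ → ℕ.≤-trans d≤ (ℕ.m≤m⊔n (degX e) (degX f))) (expand-degX e))
                                (All.map (λ d≤ → ℕ.≤-trans d≤ (ℕ.m≤n⊔m (degX e) (degX f))) (expand-degX f))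
  expand-degX (e ⊗ f) = All.concat⁺ (All.map⁺ (All.map (λ d≤ →
                          All.map⁺ (All.map (ℕ.+-mono-≤ d≤) (expand-degX f))) (expand-degX e)))

  degX-translate : ∀ {m} (e : UExpr R m) → degX (translate e) ≡ degX e
  degX-translate X       = ≡.refl
  degX-translate (U _)   = ≡.refl
  degX-translate (K _)   = ≡.refl
  degX-translate (e ⊕ f) = ≡.cong₂ _⊔_ (degX-translate e) (degX-translate f)
  degX-translate (e ⊗ f) = ≡.cong₂ ℕ._+_ (degX-translate e) (degX-translate f)

  _⊕U_ : ∀ {m} → UExpr R m → Fin m → UExpr R m
  e ⊕U i = e ⊕ U i

  module _ {m : ℕ} where

    translate-foldl : ∀ (e : UExpr R m) is → translate (foldl _⊕U_ e is) ≡ foldl _⊕U_ (translate e) (map Fin.suc is)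
    translate-foldl e []       = ≡.refl
    translate-foldl e (i ∷ is) = translate-foldl (e ⊕ U i) is

    translate-foldr : ∀ (es : List (UExpr R m)) →
      translate (foldr _⊗_ (K 1#) es) ≡ foldr _⊗_ (K 1#) (map translate es)
    translate-foldr []       = ≡.refl
    translate-foldr (e ∷ es) = ≡.cong (translate e ⊗_) (translate-foldr es)

  factor-suc : ∀ n j → factor R (suc n) (suc j) ≡ translate (factor R n j)
  factor-suc n j = ≡.sym (begin
    translate (foldl _⊕U_ X (take j (allFin n)))
      ≡⟨ translate-foldl X (take j (allFin n)) ⟩
    foldl _⊕U_ (X ⊕ U Fin.zero) (map Fin.suc (take j (allFin n)))
      ≡⟨ ≡.cong (foldl _⊕U_ (X ⊕ U Fin.zero)) (List.take-map j (allFin n)) ⟨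
    foldl _⊕U_ (X ⊕ U Fin.zero) (take j (map Fin.suc (allFin n)))
      ≡⟨ ≡.cong (λ is → foldl _⊕U_ (X ⊕ U Fin.zero) (take j is)) (List.map-tabulate (λ i → i) Fin.suc) ⟩
    factor R (suc n) (suc j)
      ∎)

  risingUmbral-suc : ∀ n → risingUmbral R (suc n) ≡ X ⊗ translate (risingUmbral R n)
  risingUmbral-suc n = ≡.cong (X ⊗_) (≡.sym (begin
    translate (foldr _⊗_ (K 1#) (map (factor R n) (upTo n)))
      ≡⟨ translate-foldr (map (factor R n) (upTo n)) ⟩
    foldr _⊗_ (K 1#) (map translate (map (factor R n) (upTo n)))
      ≡⟨ ≡.cong (foldr _⊗_ (K 1#)) factors ⟩
    foldr _⊗_ (K 1#) (map (factor R (suc n)) (applyUpTo suc n))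
      ∎))
    where
    factors : map translate (map (factor R n) (upTo n)) ≡ map (factor R (suc n)) (applyUpTo suc n)
    factors = begin
      map translate (map (factor R n) (upTo n))      ≡⟨ List.map-∘ (upTo n) ⟨
      map (translate ∘ factor R n) (upTo n)          ≡⟨ List.map-cong (λ j → ≡.sym (factor-suc n j)) (upTo n) ⟩
      map (factor R (suc n) ∘ suc) (upTo n)          ≡⟨ List.map-∘ (upTo n) ⟩
      map (factor R (suc n)) (map suc (upTo n))      ≡⟨ ≡.cong (map (factor R (suc n))) (List.map-upTo suc n) ⟩
      map (factor R (suc n)) (applyUpTo suc n)       ∎

  degX-risingUmbral : ∀ n → degX (risingUmbral R n) ≡ n
  degX-risingUmbral zero    = ≡.refl
  degX-risingUmbral (suc n) = ≡.trans (≡.cong degX (risingUmbral-suc n))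
    (≡.cong suc (≡.trans (degX-translate (risingUmbral R n)) (degX-risingUmbral n)))

module _ {c ℓ : Level} (R : CommutativeRing c ℓ) where
  open CommutativeRing R
  open UmbralSyntax R
  open import Algebra.Properties.Monoid.Mult +-monoid
    using (×-cong; ×-congʳ; ×-congˡ; ×-homo-0; ×-homo-1; ×-homo-+; ×-assocˡ) renaming (_×_ to _·ₙ_)
  open import Algebra.Properties.CommutativeMonoid.Mult +-commutativeMonoid using (×-distrib-+)
  open import Algebra.Properties.Semiring.Mult semiring using (×-comm-*; ×-assoc-*)
  open import Algebra.Properties.Group +-group using (identityˡ-unique)
  open import Relation.Binary.Reasoning.Setoid setoid
  open Algebra.Properties.CommutativeSemigroup +-commutativeSemigroup
    using () renaming (interchange to +-interchange; x∙yz≈y∙xz to x+yz≈y+xz)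
  open Algebra.Properties.CommutativeSemigroup *-commutativeSemigroup
    using () renaming (x∙yz≈y∙xz to x*yz≈y*xz)
  open Algebra.Properties.CommutativeSemigroup ℕ.+-commutativeSemigroup
    using () renaming (xy∙z≈xz∙y to +-right-comm)

  ×-zeroʳ : ∀ n → n ·ₙ 0# ≈ 0#
  ×-zeroʳ zero    = refl
  ×-zeroʳ (suc n) = trans (+-identityˡ _) (×-zeroʳ n)

  ×-zero : ∀ k {y} → y ≈ 0# → k ·ₙ y ≈ 0#
  ×-zero k y≈0 = trans (×-congʳ k y≈0) (×-zeroʳ k)

  ×-*-zeroʳ : ∀ k x {y} → y ≈ 0# → k ·ₙ (x * y) ≈ 0#
  ×-*-zeroʳ k x y≈0 = ×-zero k (trans (*-congˡ y≈0) (zeroʳ x))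

  ×-swap : ∀ m n x → m ·ₙ (n ·ₙ x) ≈ n ·ₙ (m ·ₙ x)
  ×-swap m n x = trans (×-assocˡ x m n) (trans (×-congˡ (ℕ.*-comm m n)) (sym (×-assocˡ x n m)))

  ≡⇒≈ : ∀ {x y} → x ≡ y → x ≈ y
  ≡⇒≈ ≡.refl = refl

  ∑< : ℕ → (ℕ → Carrier) → Carrier
  ∑< = Σ< R

  syntax ∑< n (λ i → x) = ∑[ i < n ] x

  ∑-cong-< : ∀ n {f g : ℕ → Carrier} → (∀ i → i < n → f i ≈ g i) → ∑< n f ≈ ∑< n g
  ∑-cong-< zero    f≈g = refl
  ∑-cong-< (suc n) f≈g = +-cong (∑-cong-< n (λ i i<n → f≈g i (ℕ.m<n⇒m<1+n i<n))) (f≈g n ℕ.≤-refl)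

  ∑-cong : ∀ n {f g : ℕ → Carrier} → (∀ i → f i ≈ g i) → ∑< n f ≈ ∑< n g
  ∑-cong n f≈g = ∑-cong-< n (λ i _ → f≈g i)

  ∑-zero : ∀ n {f : ℕ → Carrier} → (∀ i → i < n → f i ≈ 0#) → ∑< n f ≈ 0#
  ∑-zero zero    f≈0 = refl
  ∑-zero (suc n) f≈0 = trans (+-cong (∑-zero n (λ i i<n → f≈0 i (ℕ.m<n⇒m<1+n i<n))) (f≈0 n ℕ.≤-refl))
                             (+-identityʳ 0#)

  ∑-distrib-+ : ∀ n (f g : ℕ → Carrier) → ∑[ i < n ] (f i + g i) ≈ ∑< n f + ∑< n g
  ∑-distrib-+ zero    f g = sym (+-identityʳ 0#)
  ∑-distrib-+ (suc n) f g = trans (+-congʳ (∑-distrib-+ n f g)) (+-interchange _ _ _ _)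

  *-distribˡ-∑ : ∀ n x (f : ℕ → Carrier) → x * ∑< n f ≈ ∑[ i < n ] (x * f i)
  *-distribˡ-∑ zero    x f = zeroʳ x
  *-distribˡ-∑ (suc n) x f = trans (distribˡ x _ _) (+-congʳ (*-distribˡ-∑ n x f))

  *-distribʳ-∑ : ∀ n x (f : ℕ → Carrier) → ∑< n f * x ≈ ∑[ i < n ] (f i * x)
  *-distribʳ-∑ zero    x f = zeroˡ x
  *-distribʳ-∑ (suc n) x f = trans (distribʳ x _ _) (+-congʳ (*-distribʳ-∑ n x f))

  ×-distrib-∑ : ∀ n m (f : ℕ → Carrier) → m ·ₙ ∑< n f ≈ ∑[ i < n ] (m ·ₙ f i)
  ×-distrib-∑ zero    m f = ×-zeroʳ m
  ×-distrib-∑ (suc n) m f = trans (×-distrib-+ _ _ m) (+-congʳ (×-distrib-∑ n m f))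

  ∑-head : ∀ n (f : ℕ → Carrier) → ∑< (suc n) f ≈ f 0 + ∑[ i < n ] f (suc i)
  ∑-head zero    f = trans (+-identityˡ _) (sym (+-identityʳ _))
  ∑-head (suc n) f = trans (+-congʳ (∑-head n f)) (+-assoc _ _ _)

  ∑-comm : ∀ n m (f : ℕ → ℕ → Carrier) → ∑[ i < n ] ∑[ j < m ] f i j ≈ ∑[ j < m ] ∑[ i < n ] f i j
  ∑-comm zero    m f = sym (∑-zero m (λ _ _ → refl))
  ∑-comm (suc n) m f = trans (+-congʳ (∑-comm n m f)) (sym (∑-distrib-+ m _ _))

  ∑-single : ∀ n {f : ℕ → Carrier} i₀ → i₀ < n → (∀ i → i < n → i ≢ i₀ → f i ≈ 0#) → ∑< n f ≈ f i₀
  ∑-single (suc n) i₀ i₀<1+n f≈0 with i₀ ℕ.≟ n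
  ... | yes ≡.refl = trans (+-congʳ (∑-zero n (λ i i<n → f≈0 i (ℕ.m<n⇒m<1+n i<n) (ℕ.<⇒≢ i<n))))
                           (+-identityˡ _)
  ... | no i₀≢n    = trans (+-cong (∑-single n i₀ (ℕ.≤∧≢⇒< (ℕ.≤-pred i₀<1+n) i₀≢n)
                                      (λ i i<n → f≈0 i (ℕ.m<n⇒m<1+n i<n)))
                                   (f≈0 n ℕ.≤-refl (i₀≢n ∘ ≡.sym)))
                           (+-identityʳ _)

  ∑-trailing-zeros : ∀ n m {f : ℕ → Carrier} → n ≤ m → (∀ i → n ≤ i → i < m → f i ≈ 0#) →
                     ∑< m f ≈ ∑< n f
  ∑-trailing-zeros n zero    z≤n   f≈0 = refl
  ∑-trailing-zeros n (suc m) n≤1+m f≈0 with n ℕ.≟ suc m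
  ... | yes ≡.refl = refl
  ... | no n≢1+m   = trans (+-cong (∑-trailing-zeros n m n≤m (λ i n≤i i<m → f≈0 i n≤i (ℕ.m<n⇒m<1+n i<m)))
                                   (f≈0 m n≤m ℕ.≤-refl))
                           (+-identityʳ _)
    where n≤m = ℕ.≤-pred (ℕ.≤∧≢⇒< n≤1+m n≢1+m)

  ∑-reverse : ∀ n (f : ℕ → Carrier) → ∑< (suc n) f ≈ ∑[ i < suc n ] f (n ∸ i)
  ∑-reverse zero    f = refl
  ∑-reverse (suc n) f = begin
    ∑< (suc n) f + f (suc n)                 ≈⟨ +-cong (∑-reverse n f) refl ⟩
    ∑[ i < suc n ] f (n ∸ i) + f (suc n)     ≈⟨ +-comm _ _ ⟩
    f (suc n) + ∑[ i < suc n ] f (n ∸ i)     ≈⟨ ∑-head (suc n) (λ i → f (suc n ∸ i)) ⟨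
    ∑[ i < suc (suc n) ] f (suc n ∸ i)       ∎

  ∑C : ℕ → (ℕ → ℕ → Carrier) → Carrier
  ∑C n F = ∑[ i < suc n ] ((n C i) ·ₙ F i (n ∸ i))

  ∑C-cong : ∀ n {F G : ℕ → ℕ → Carrier} → (∀ i j → i ≤ n → F i j ≈ G i j) → ∑C n F ≈ ∑C n G
  ∑C-cong n F≈G = ∑-cong-< (suc n) (λ i i<1+n → ×-congʳ (n C i) (F≈G i (n ∸ i) (ℕ.≤-pred i<1+n)))

  ∑C-zero : ∀ n {F : ℕ → ℕ → Carrier} → (∀ i j → F i j ≈ 0#) → ∑C n F ≈ 0#
  ∑C-zero n F≈0 = ∑-zero (suc n) (λ i _ → ×-zero (n C i) (F≈0 i (n ∸ i)))

  ∑C-distrib-+ : ∀ n (F G : ℕ → ℕ → Carrier) → ∑C n (λ i j → F i j + G i j) ≈ ∑C n F + ∑C n G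
  ∑C-distrib-+ n F G = trans (∑-cong (suc n) (λ i → ×-distrib-+ _ _ (n C i))) (∑-distrib-+ (suc n) _ _)

  ∑C-flip : ∀ n (F : ℕ → ℕ → Carrier) → ∑C n F ≈ ∑C n (λ i j → F j i)
  ∑C-flip n F = trans (∑-reverse n _) (∑-cong-< (suc n) reflect)
    where
    reflect : ∀ i → i < suc n → (n C (n ∸ i)) ·ₙ F (n ∸ i) (n ∸ (n ∸ i)) ≈ (n C i) ·ₙ F (n ∸ i) i
    reflect i (s≤s i≤n) =
      ×-cong (≡.sym (nCk≡nC[n∸k] i≤n)) (≡⇒≈ (≡.cong (F (n ∸ i)) (ℕ.m∸[m∸n]≡n i≤n)))

  ∑C-pascal : ∀ N (H : ℕ → ℕ → Carrier) → ∑C (suc N) H ≈ ∑C N (λ i j → H (suc i) j + H i (suc j))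
  ∑C-pascal N H = begin
    ∑C (suc N) H
      ≈⟨ ∑-head (suc N) _ ⟩
    H₀ + ∑[ i < suc N ] ((suc N C suc i) ·ₙ H (suc i) (N ∸ i))
      ≈⟨ +-congˡ (∑-cong (suc N) (λ i → ×-congˡ (≡.sym (nCk+nC[k+1]≡[n+1]C[k+1] N i)))) ⟩
    H₀ + ∑[ i < suc N ] ((N C i ℕ.+ N C suc i) ·ₙ H (suc i) (N ∸ i))
      ≈⟨ +-congˡ (trans (∑-cong (suc N) (λ i → ×-homo-+ _ (N C i) (N C suc i))) (∑-distrib-+ (suc N) _ _)) ⟩
    H₀ + (∑C N (λ i j → H (suc i) j) + upper)
      ≈⟨ x+yz≈y+xz _ _ _ ⟩
    ∑C N (λ i j → H (suc i) j) + (H₀ + upper)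
      ≈⟨ +-congˡ (+-congˡ upper≈) ⟩
    ∑C N (λ i j → H (suc i) j) + (H₀ + ∑[ i < N ] ((N C suc i) ·ₙ H (suc i) (suc (N ∸ suc i))))
      ≈⟨ +-congˡ (∑-head N _) ⟨
    ∑C N (λ i j → H (suc i) j) + ∑C N (λ i j → H i (suc j))
      ≈⟨ ∑C-distrib-+ N (λ i j → H (suc i) j) (λ i j → H i (suc j)) ⟨
    ∑C N (λ i j → H (suc i) j + H i (suc j))
      ∎
    where
    H₀ : Carrier
    H₀ = 1 ·ₙ H 0 (suc N)
    upper : Carrier
    upper = ∑[ i < suc N ] ((N C suc i) ·ₙ H (suc i) (N ∸ i))
    upper≈ : upper ≈ ∑[ i < N ] ((N C suc i) ·ₙ H (suc i) (suc (N ∸ suc i)))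
    upper≈ = trans (+-cong (∑-cong-< N (λ i i<N →
                              ×-congʳ (N C suc i) (≡⇒≈ (≡.cong (H (suc i)) (ℕ.+-∸-assoc 1 i<N)))))
                           (trans (×-congˡ (k>n⇒nCk≡0 (ℕ.n<1+n N))) (×-homo-0 (H (suc N) (N ∸ N)))))
                   (+-identityʳ _)

  ∑C-vandermonde : ∀ d e (G : ℕ → ℕ → Carrier) →
                   ∑C d (λ i j → ∑C e (λ i′ j′ → G (i ℕ.+ i′) (j ℕ.+ j′))) ≈ ∑C (d ℕ.+ e) G
  ∑C-vandermonde zero    e G = trans (+-identityˡ _) (×-homo-1 _)
  ∑C-vandermonde (suc d) e G = begin
    ∑C (suc d) (λ i j → ∑C e (λ i′ j′ → G (i ℕ.+ i′) (j ℕ.+ j′)))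
      ≈⟨ trans (∑C-pascal d F) (∑C-distrib-+ d (F ∘ suc) (λ i j → F i (suc j))) ⟩
    ∑C d (λ i j → ∑C e (λ i′ j′ → G (suc (i ℕ.+ i′)) (j ℕ.+ j′)))
      + ∑C d (λ i j → ∑C e (λ i′ j′ → G (i ℕ.+ i′) (suc (j ℕ.+ j′))))
      ≈⟨ +-cong (∑C-vandermonde d e (G ∘ suc)) (∑C-vandermonde d e (λ t u → G t (suc u))) ⟩
    ∑C (d ℕ.+ e) (G ∘ suc) + ∑C (d ℕ.+ e) (λ t u → G t (suc u))
      ≈⟨ trans (∑C-pascal (d ℕ.+ e) G) (∑C-distrib-+ (d ℕ.+ e) (G ∘ suc) (λ t u → G t (suc u))) ⟨
    ∑C (suc d ℕ.+ e) G
      ∎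
    where
    F : ℕ → ℕ → Carrier
    F i j = ∑C e (λ i′ j′ → G (i ℕ.+ i′) (j ℕ.+ j′))

  ∑-∑C-comm : ∀ m n (F : ℕ → ℕ → ℕ → Carrier) →
              ∑[ k < m ] ∑C n (F k) ≈ ∑C n (λ i j → ∑[ k < m ] F k i j)
  ∑-∑C-comm m n F = trans (∑-comm m (suc n) _) (∑-cong (suc n) (λ i → sym (×-distrib-∑ m (n C i) _)))

  ×-*-distrib-∑C : ∀ k b n (F : ℕ → ℕ → Carrier) →
                   k ·ₙ (b * ∑C n F) ≈ ∑C n (λ i j → k ·ₙ (b * F i j))
  ×-*-distrib-∑C k b n F = begin
    k ·ₙ (b * ∑C n F)
      ≈⟨ trans (×-congʳ k (*-distribˡ-∑ (suc n) b _)) (×-distrib-∑ (suc n) k _) ⟩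
    ∑[ i < suc n ] (k ·ₙ (b * ((n C i) ·ₙ F i (n ∸ i))))
      ≈⟨ ∑-cong (suc n) (λ i → trans (×-congʳ k (×-comm-* (n C i) b _)) (×-swap k (n C i) _)) ⟩
    ∑C n (λ i j → k ·ₙ (b * F i j))
      ∎

  -- The coefficient of xᵃ yᵇ in q(x + y), for q given by its coefficients.
  atSum : (ℕ → Carrier) → Poly2 R
  atSum q a b = ((a ℕ.+ b) C a) ·ₙ q (a ℕ.+ b)

  atSum-comm : ∀ q x y → atSum q x y ≈ atSum q y x
  atSum-comm q x y = ×-cong (C+-comm x y) (≡⇒≈ (≡.cong q (ℕ.+-comm x y)))

  BinomialIdentityAt : (ℕ → ℕ → Carrier) → ℕ → Set ℓ
  BinomialIdentityAt P n = ∀ x y → atSum (P n) x y ≈ ∑C n (λ i j → P i x * P j y)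

  BinomialIdentity : (ℕ → ℕ → Carrier) → Set ℓ
  BinomialIdentity P = ∀ n → BinomialIdentityAt P n

  BinomialIdentity-cong : ∀ {P Q} → (∀ n j → P n j ≈ Q n j) → BinomialIdentity P → BinomialIdentity Q
  BinomialIdentity-cong {P} {Q} P≈Q P-binomial n x y = begin
    atSum (Q n) x y                    ≈⟨ ×-congʳ ((x ℕ.+ y) C x) (P≈Q n (x ℕ.+ y)) ⟨
    atSum (P n) x y                    ≈⟨ P-binomial n x y ⟩
    ∑C n (λ i j → P i x * P j y)       ≈⟨ ∑C-cong n (λ i j _ → *-cong (P≈Q i x) (P≈Q j y)) ⟩
    ∑C n (λ i j → Q i x * Q j y)       ∎

  xTimes yTimes : Poly2 R → Poly2 R
  xTimes G zero    b       = 0#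
  xTimes G (suc a) b       = G a b
  yTimes G a       zero    = 0#
  yTimes G a       (suc b) = G a b

  const₂-zero : ∀ a b → const₂ R 0# a b ≈ 0#
  const₂-zero zero    zero    = refl
  const₂-zero zero    (suc b) = refl
  const₂-zero (suc a) b       = refl

  atSum-x+y : ∀ q a b →
    atSum q a b ≈ const₂ R (q 0) a b + (xTimes (atSum (q ∘ suc)) a b + yTimes (atSum (q ∘ suc)) a b)
  atSum-x+y q zero    zero    = sym (+-congˡ (+-identityʳ 0#))
  atSum-x+y q zero    (suc b) = sym (trans (+-identityˡ _) (+-identityˡ _))
  atSum-x+y q (suc a) b       = begin
    ((suc a ℕ.+ b) C suc a) ·ₙ q′ (a ℕ.+ b)
      ≈⟨ ×-congˡ (≡.sym (nCk+nC[k+1]≡[n+1]C[k+1] (a ℕ.+ b) a)) ⟩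
    ((a ℕ.+ b) C a ℕ.+ (a ℕ.+ b) C suc a) ·ₙ q′ (a ℕ.+ b)
      ≈⟨ ×-homo-+ _ ((a ℕ.+ b) C a) ((a ℕ.+ b) C suc a) ⟩
    atSum q′ a b + ((a ℕ.+ b) C suc a) ·ₙ q′ (a ℕ.+ b)
      ≈⟨ +-congˡ (upper b) ⟩
    atSum q′ a b + yTimes (atSum q′) (suc a) b
      ≈⟨ +-identityˡ _ ⟨
    0# + (atSum q′ a b + yTimes (atSum q′) (suc a) b)
      ∎
    where
    q′ : ℕ → Carrier
    q′ = q ∘ suc
    upper : ∀ b → ((a ℕ.+ b) C suc a) ·ₙ q′ (a ℕ.+ b) ≈ yTimes (atSum q′) (suc a) b
    upper zero    = trans (×-congˡ (k>n⇒nCk≡0 (s≤s (ℕ.≤-reflexive (ℕ.+-identityʳ a))))) (×-homo-0 (q′ (a ℕ.+ 0)))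
    upper (suc b) = ≡⇒≈ (≡.cong (λ m → (m C suc a) ·ₙ q′ m) (ℕ.+-suc a b))

  xTimes-cong : ∀ {G G′ : Poly2 R} → _≈₂_ R G G′ → _≈₂_ R (xTimes G) (xTimes G′)
  xTimes-cong G≈G′ zero    b = refl
  xTimes-cong G≈G′ (suc a) b = G≈G′ a b

  yTimes-cong : ∀ {G G′ : Poly2 R} → _≈₂_ R G G′ → _≈₂_ R (yTimes G) (yTimes G′)
  yTimes-cong G≈G′ a zero    = refl
  yTimes-cong G≈G′ a (suc b) = G≈G′ a b

  X+Y-row₀ : ∀ (G : Poly2 R) a b → ∑[ j < suc b ] (X+Y R 0 j * G a (b ∸ j)) ≈ yTimes G a b
  X+Y-row₀ G a zero    = trans (+-identityˡ _) (zeroˡ _)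
  X+Y-row₀ G a (suc b) = begin
    ∑[ j < suc (suc b) ] (X+Y R 0 j * G a (suc b ∸ j))
      ≈⟨ trans (∑-head (suc b) _) (+-cong (zeroˡ _) (∑-head b _)) ⟩
    0# + (1# * G a b + ∑[ j < b ] (0# * G a (b ∸ suc j)))
      ≈⟨ trans (+-identityˡ _) (+-cong (*-identityˡ _) (∑-zero b (λ j _ → zeroˡ _))) ⟩
    G a b + 0#
      ≈⟨ +-identityʳ _ ⟩
    G a b
      ∎

  X+Y-row₁ : ∀ (G : Poly2 R) a b → ∑[ j < suc b ] (X+Y R 1 j * G a (b ∸ j)) ≈ G a b
  X+Y-row₁ G a b =
    trans (∑-head b (λ j → X+Y R 1 j * G a (b ∸ j)))
          (trans (+-cong (*-identityˡ _) (∑-zero b (λ j _ → zeroˡ _))) (+-identityʳ _))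

  X+Y-*₂ : ∀ (G : Poly2 R) a b → _*₂_ R (X+Y R) G a b ≈ xTimes G a b + yTimes G a b
  X+Y-*₂ G zero    b = +-congˡ (X+Y-row₀ G 0 b)
  X+Y-*₂ G (suc a) b = begin
    _*₂_ R (X+Y R) G (suc a) b
      ≈⟨ trans (∑-head (suc a) _) (+-congˡ (∑-head a _)) ⟩
    ∑[ j < suc b ] (X+Y R 0 j * G (suc a) (b ∸ j))
      + (∑[ j < suc b ] (X+Y R 1 j * G a (b ∸ j))
         + ∑[ i < a ] ∑[ j < suc b ] (0# * G (a ∸ suc i) (b ∸ j)))
      ≈⟨ +-cong (X+Y-row₀ G (suc a) b)
                (trans (+-cong (X+Y-row₁ G a b) (∑-zero a (λ i _ → ∑-zero (suc b) (λ j _ → zeroˡ _))))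
                       (+-identityʳ _)) ⟩
    yTimes G (suc a) b + G a b
      ≈⟨ +-comm _ _ ⟩
    G a b + yTimes G (suc a) b
      ∎

  coeff-atX+Y : ∀ p → _≈₂_ R (atX+Y R p) (atSum (coeff R p))
  coeff-atX+Y []       a b = trans (const₂-zero a b) (sym (×-zeroʳ ((a ℕ.+ b) C a)))
  coeff-atX+Y (r ∷ rs) a b = begin
    const₂ R r a b + _*₂_ R (X+Y R) (atX+Y R rs) a b
      ≈⟨ +-congˡ (X+Y-*₂ (atX+Y R rs) a b) ⟩
    const₂ R r a b + (xTimes (atX+Y R rs) a b + yTimes (atX+Y R rs) a b)
      ≈⟨ +-congˡ (+-cong (xTimes-cong (coeff-atX+Y rs) a b) (yTimes-cong (coeff-atX+Y rs) a b)) ⟩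
    const₂ R r a b + (xTimes (atSum (coeff R rs)) a b + yTimes (atSum (coeff R rs)) a b)
      ≈⟨ atSum-x+y (coeff R (r ∷ rs)) a b ⟨
    atSum (coeff R (r ∷ rs)) a b
      ∎

  coeff-inX*inY : ∀ p q a b → _*₂_ R (inX R p) (inY R q) a b ≈ coeff R p a * coeff R q b
  coeff-inX*inY p q a b = begin
    ∑[ i < suc a ] ∑[ j < suc b ] (inX R p i j * inY R q (a ∸ i) (b ∸ j))
      ≈⟨ ∑-single (suc a) a ℕ.≤-refl (λ i i<1+a i≢a → ∑-zero (suc b) (λ j _ →
           trans (*-congˡ (inY-zero (a ∸ i) (ℕ.m<n⇒0<n∸m (ℕ.≤∧≢⇒< (ℕ.≤-pred i<1+a) i≢a)))) (zeroʳ _))) ⟩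
    ∑[ j < suc b ] (inX R p a j * inY R q (a ∸ a) (b ∸ j))
      ≈⟨ ∑-single (suc b) 0 (s≤s z≤n) (λ { zero _ 0≢0 → ⊥-elim (0≢0 ≡.refl) ; (suc j) _ _ → zeroˡ _ }) ⟩
    coeff R p a * inY R q (a ∸ a) b
      ≈⟨ *-congˡ (≡⇒≈ (≡.cong (λ m → inY R q m b) (ℕ.n∸n≡0 a))) ⟩
    coeff R p a * coeff R q b
      ∎
    where
    inY-zero : ∀ m {b′} → 0 < m → inY R q m b′ ≈ 0#
    inY-zero (suc m) _ = refl

  binomialType⇔binomialIdentity : ∀ p → BinomialType R p ⇔ BinomialIdentity (coeff R ∘ p)
  binomialType⇔binomialIdentity p = mk⇔
    (λ binomial n x y → trans (sym (coeff-atX+Y (p n) x y)) (trans (binomial n x y) (products n x y)))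
    (λ identity n x y → trans (coeff-atX+Y (p n) x y) (trans (identity n x y) (sym (products n x y))))
    where
    products : ∀ n x y → ∑[ i < suc n ] ((n C i) ·ₙ _*₂_ R (inX R (p i)) (inY R (p (n ∸ i))) x y)
                         ≈ ∑C n (λ i j → coeff R (p i) x * coeff R (p j) y)
    products n x y = ∑-cong (suc n) (λ i → ×-congʳ (n C i) (coeff-inX*inY (p i) (p (n ∸ i)) x y))

  -- The coefficient of xᵐ in E[q(x + μ)], for q of degree at most n and E[μᵏ] = a k.
  translateE : (ℕ → Carrier) → ℕ → (ℕ → Carrier) → ℕ → Carrier
  translateE a n q m = ∑[ k < suc n ] (((m ℕ.+ k) C m) ·ₙ (a k * q (m ℕ.+ k)))

  -- Coefficients of p₀ = 1, pₙ₊₁(x) = x E[pₙ(x + μ)].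
  rising : (ℕ → Carrier) → ℕ → ℕ → Carrier
  rising a zero    zero    = 1#
  rising a zero    (suc j) = 0#
  rising a (suc n) zero    = 0#
  rising a (suc n) (suc j) = translateE a n (rising a n) j

  translateE-*ʳ : ∀ a n q z m → translateE a n (λ j → q j * z) m ≈ translateE a n q m * z
  translateE-*ʳ a n q z m = trans (∑-cong (suc n) reassoc) (sym (*-distribʳ-∑ (suc n) z _))
    where
    reassoc : ∀ k → ((m ℕ.+ k) C m) ·ₙ (a k * (q (m ℕ.+ k) * z)) ≈ ((m ℕ.+ k) C m) ·ₙ (a k * q (m ℕ.+ k)) * z
    reassoc k = trans (×-congʳ b (sym (*-assoc (a k) (q (m ℕ.+ k)) z))) (sym (×-assoc-* b (a k * q (m ℕ.+ k)) z))
      where b = (m ℕ.+ k) C m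

  module _ (a : ℕ → Carrier) where

    rising-above : ∀ n j → n < j → rising a n j ≈ 0#
    rising-above zero    (suc j) _         = refl
    rising-above (suc n) (suc j) (s≤s n<j) = ∑-zero (suc n) (λ k _ →
      ×-*-zeroʳ ((j ℕ.+ k) C j) (a k) (rising-above n (j ℕ.+ k) (ℕ.≤-trans n<j (ℕ.m≤m+n j k))))

    translateE-rising : ∀ {i n} → i ≤ n → ∀ m → translateE a n (rising a i) m ≈ rising a (suc i) (suc m)
    translateE-rising {i} {n} i≤n m = ∑-trailing-zeros (suc i) (suc n) (s≤s i≤n) (λ k i<k _ →
      ×-*-zeroʳ ((m ℕ.+ k) C m) (a k) (rising-above i (m ℕ.+ k) (ℕ.≤-trans i<k (ℕ.m≤n+m k m))))

    rising-diagonal : a 0 ≈ 1# → ∀ n → rising a n n ≈ 1#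
    rising-diagonal a₀≈1 zero    = refl
    rising-diagonal a₀≈1 (suc n) = begin
      ∑[ k < suc n ] (((n ℕ.+ k) C n) ·ₙ (a k * rising a n (n ℕ.+ k)))
        ≈⟨ ∑-single (suc n) 0 (s≤s z≤n) (λ k _ k≢0 →
             ×-*-zeroʳ ((n ℕ.+ k) C n) (a k) (rising-above n (n ℕ.+ k) (n<n+k k≢0))) ⟩
      ((n ℕ.+ 0) C n) ·ₙ (a 0 * rising a n (n ℕ.+ 0))
        ≈⟨ ≡⇒≈ (≡.cong (λ m → (m C n) ·ₙ (a 0 * rising a n m)) (ℕ.+-identityʳ n)) ⟩
      (n C n) ·ₙ (a 0 * rising a n n)
        ≈⟨ trans (×-congˡ (nCn≡1 n)) (×-homo-1 _) ⟩
      a 0 * rising a n n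
        ≈⟨ trans (*-cong a₀≈1 (rising-diagonal a₀≈1 n)) (*-identityˡ 1#) ⟩
      1#
        ∎
      where
      n<n+k : ∀ {k} → k ≢ 0 → n < n ℕ.+ k
      n<n+k {zero}  k≢0 = ⊥-elim (k≢0 ≡.refl)
      n<n+k {suc k} _   = ℕ.m<m+n n (s≤s z≤n)

    -- x E[pₙ(x + y + μ)] = Σᵢ C(n,i) pᵢ₊₁(x) pₙ₋ᵢ(y), by the identity for pₙ at (x + μ, y).
    atSum-translateEˣ : ∀ n → BinomialIdentityAt (rising a) n → ∀ x y →
      atSum (translateE a n (rising a n)) x y ≈ ∑C n (λ i j → rising a (suc i) (suc x) * rising a j y)
    atSum-translateEˣ n identity x y = begin
      ((x ℕ.+ y) C x) ·ₙ ∑[ k < suc n ] (((x ℕ.+ y ℕ.+ k) C (x ℕ.+ y)) ·ₙ (a k * Q n (x ℕ.+ y ℕ.+ k)))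
        ≈⟨ trans (×-distrib-∑ (suc n) ((x ℕ.+ y) C x) _) (∑-cong (suc n) exchange) ⟩
      ∑[ k < suc n ] (((x ℕ.+ k) C x) ·ₙ (a k * atSum (Q n) (x ℕ.+ k) y))
        ≈⟨ ∑-cong (suc n) (λ k → ×-congʳ ((x ℕ.+ k) C x) (*-congˡ (identity (x ℕ.+ k) y))) ⟩
      ∑[ k < suc n ] (((x ℕ.+ k) C x) ·ₙ (a k * ∑C n (λ i j → Q i (x ℕ.+ k) * Q j y)))
        ≈⟨ trans (∑-cong (suc n) (λ k → ×-*-distrib-∑C ((x ℕ.+ k) C x) (a k) n (F k)))
                 (∑-∑C-comm (suc n) n (λ k i j → ((x ℕ.+ k) C x) ·ₙ (a k * F k i j))) ⟩
      ∑C n (λ i j → translateE a n (λ m → Q i m * Q j y) x)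
        ≈⟨ ∑C-cong n (λ i j i≤n → trans (translateE-*ʳ a n (Q i) (Q j y) x) (*-congʳ (translateE-rising i≤n x))) ⟩
      ∑C n (λ i j → Q (suc i) (suc x) * Q j y)
        ∎
      where
      Q : ℕ → ℕ → Carrier
      Q = rising a
      F : ℕ → ℕ → ℕ → Carrier
      F k i j = Q i (x ℕ.+ k) * Q j y
      exchange : ∀ k →
        ((x ℕ.+ y) C x) ·ₙ (((x ℕ.+ y ℕ.+ k) C (x ℕ.+ y)) ·ₙ (a k * Q n (x ℕ.+ y ℕ.+ k)))
        ≈ ((x ℕ.+ k) C x) ·ₙ (a k * atSum (Q n) (x ℕ.+ k) y)
      exchange k = begin
        c₁ ·ₙ (c₂ ·ₙ t)                       ≈⟨ ×-assocˡ t c₁ c₂ ⟩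
        (c₁ ℕ.* c₂) ·ₙ t                      ≈⟨ ×-congˡ (C+-exchange x y k) ⟩
        (c₃ ℕ.* c₄) ·ₙ t                      ≈⟨ ×-assocˡ t c₃ c₄ ⟨
        c₃ ·ₙ (c₄ ·ₙ t)                       ≈⟨ ×-congʳ c₃ (×-comm-* c₄ (a k) (Q n (x ℕ.+ y ℕ.+ k))) ⟨
        c₃ ·ₙ (a k * (c₄ ·ₙ Q n (x ℕ.+ y ℕ.+ k)))
          ≈⟨ ×-congʳ c₃ (*-congˡ (×-congʳ c₄ (≡⇒≈ (≡.cong (Q n) (+-right-comm x y k))))) ⟩
        c₃ ·ₙ (a k * atSum (Q n) (x ℕ.+ k) y) ∎
        where
        c₁ c₂ c₃ c₄ : ℕ
        c₁ = (x ℕ.+ y) C x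
        c₂ = (x ℕ.+ y ℕ.+ k) C (x ℕ.+ y)
        c₃ = (x ℕ.+ k) C x
        c₄ = (x ℕ.+ k ℕ.+ y) C (x ℕ.+ k)
        t : Carrier
        t = a k * Q n (x ℕ.+ y ℕ.+ k)

    atSum-translateEʸ : ∀ n → BinomialIdentityAt (rising a) n → ∀ x y →
      atSum (translateE a n (rising a n)) x y ≈ ∑C n (λ i j → rising a i x * rising a (suc j) (suc y))
    atSum-translateEʸ n identity x y = begin
      atSum (translateE a n (rising a n)) x y
        ≈⟨ trans (atSum-comm (translateE a n (rising a n)) x y) (atSum-translateEˣ n identity y x) ⟩
      ∑C n (λ i j → rising a (suc i) (suc y) * rising a j x)
        ≈⟨ trans (∑C-flip n (λ i j → rising a (suc i) (suc y) * rising a j x))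
                 (∑C-cong n (λ i j _ → *-comm (rising a (suc j) (suc y)) (rising a i x))) ⟩
      ∑C n (λ i j → rising a i x * rising a (suc j) (suc y))
        ∎

    rising-binomial : BinomialIdentity (rising a)
    rising-binomial zero    zero    zero    = sym (trans (+-identityˡ _) (×-congʳ 1 (*-identityˡ 1#)))
    rising-binomial zero    zero    (suc y) = trans (×-zeroʳ 1)
      (sym (trans (+-identityˡ _) (trans (×-congʳ 1 (zeroʳ 1#)) (×-zeroʳ 1))))
    rising-binomial zero    (suc x) y       = trans (×-zeroʳ ((suc x ℕ.+ y) C suc x))
      (sym (trans (+-identityˡ _) (trans (×-congʳ 1 (zeroˡ (rising a 0 y))) (×-zeroʳ 1))))
    rising-binomial (suc n) x y = begin
      atSum (Q (suc n)) x y
        ≈⟨ atSum-x+y (Q (suc n)) x y ⟩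
      const₂ R 0# x y + (xTimes (atSum Tr) x y + yTimes (atSum Tr) x y)
        ≈⟨ trans (+-cong (const₂-zero x y) (+-cong (x-part x y) (y-part x y))) (+-identityˡ _) ⟩
      ∑C n (λ i j → Q (suc i) x * Q j y) + ∑C n (λ i j → Q i x * Q (suc j) y)
        ≈⟨ ∑C-distrib-+ n (λ i j → Q (suc i) x * Q j y) (λ i j → Q i x * Q (suc j) y) ⟨
      ∑C n (λ i j → Q (suc i) x * Q j y + Q i x * Q (suc j) y)
        ≈⟨ ∑C-pascal n (λ i j → Q i x * Q j y) ⟨
      ∑C (suc n) (λ i j → Q i x * Q j y)
        ∎
      where
      Q : ℕ → ℕ → Carrier
      Q = rising a
      Tr : ℕ → Carrier
      Tr = translateE a n (Q n)
      x-part : ∀ x y → xTimes (atSum Tr) x y ≈ ∑C n (λ i j → Q (suc i) x * Q j y)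
      x-part zero    y = sym (∑C-zero n {λ i j → Q (suc i) 0 * Q j y} (λ i j → zeroˡ (Q j y)))
      x-part (suc x) y = atSum-translateEˣ n (rising-binomial n) x y
      y-part : ∀ x y → yTimes (atSum Tr) x y ≈ ∑C n (λ i j → Q i x * Q (suc j) y)
      y-part x zero    = sym (∑C-zero n {λ i j → Q i x * Q (suc j) 0} (λ i j → zeroʳ (Q i x)))
      y-part x (suc y) = atSum-translateEʸ n (rising-binomial n) x y

  rising-cong : ∀ {a b} n → (∀ k → k < n → a k ≈ b k) → ∀ j → rising a n j ≈ rising b n j
  rising-cong zero    a≈b zero    = refl
  rising-cong zero    a≈b (suc j) = refl
  rising-cong (suc n) a≈b zero    = refl
  rising-cong (suc n) a≈b (suc j) = ∑-cong-< (suc n) (λ k k<1+n → ×-congʳ ((j ℕ.+ k) C j)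
    (*-cong (a≈b k k<1+n) (rising-cong n (λ k′ k′<n → a≈b k′ (ℕ.m<n⇒m<1+n k′<n)) (j ℕ.+ k))))

  -- E R a e k unfolds to ∑ₘ (coeffE a k) (expand R e).
  ∑ₘ : ∀ {m} → (Mono R m → Carrier) → List (Mono R m) → Carrier
  ∑ₘ ψ = foldr (λ s acc → ψ s + acc) 0#

  coeffE : ∀ {m} → (ℕ → Carrier) → ℕ → Mono R m → Carrier
  coeffE {m} a k (r , d , v) = if d ≡ᵇ k then r * ∏Fin R m (λ i → a (v i)) else 0#

  module _ {m : ℕ} where

    ∑ₘ-cong : ∀ {ψ χ : Mono R m → Carrier} → (∀ s → ψ s ≈ χ s) → ∀ ss → ∑ₘ ψ ss ≈ ∑ₘ χ ss
    ∑ₘ-cong ψ≈χ []       = refl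
    ∑ₘ-cong ψ≈χ (s ∷ ss) = +-cong (ψ≈χ s) (∑ₘ-cong ψ≈χ ss)

    ∑ₘ-zero : ∀ {ψ : Mono R m → Carrier} → (∀ s → ψ s ≈ 0#) → ∀ ss → ∑ₘ ψ ss ≈ 0#
    ∑ₘ-zero ψ≈0 []       = refl
    ∑ₘ-zero ψ≈0 (s ∷ ss) = trans (+-cong (ψ≈0 s) (∑ₘ-zero ψ≈0 ss)) (+-identityʳ 0#)

    ∑ₘ-++ : ∀ (ψ : Mono R m → Carrier) ss ts → ∑ₘ ψ (ss ++ ts) ≈ ∑ₘ ψ ss + ∑ₘ ψ ts
    ∑ₘ-++ ψ []       ts = sym (+-identityˡ _)
    ∑ₘ-++ ψ (s ∷ ss) ts = trans (+-congˡ (∑ₘ-++ ψ ss ts)) (sym (+-assoc _ _ _))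

    ∑ₘ-map : ∀ (ψ : Mono R m → Carrier) (f : Mono R m → Mono R m) ss → ∑ₘ ψ (map f ss) ≡ ∑ₘ (ψ ∘ f) ss
    ∑ₘ-map ψ f []       = ≡.refl
    ∑ₘ-map ψ f (s ∷ ss) = ≡.cong (ψ (f s) +_) (∑ₘ-map ψ f ss)

    ∑ₘ-⊗ : ∀ (ψ : Mono R m → Carrier) (e f : UExpr R m) →
           ∑ₘ ψ (expand R (e ⊗ f)) ≈ ∑ₘ (λ s → ∑ₘ (ψ ∘ mulMono R s) (expand R f)) (expand R e)
    ∑ₘ-⊗ ψ e f = concatMap-products (expand R e)
      where
      concatMap-products : ∀ ss → ∑ₘ ψ (concatMap (λ s → map (mulMono R s) (expand R f)) ss)
                                  ≈ ∑ₘ (λ s → ∑ₘ (ψ ∘ mulMono R s) (expand R f)) ss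
      concatMap-products []       = refl
      concatMap-products (s ∷ ss) = trans (∑ₘ-++ ψ (map (mulMono R s) (expand R f)) _)
        (+-cong (≡⇒≈ (∑ₘ-map ψ (mulMono R s) (expand R f))) (concatMap-products ss))

    ∑ₘ-∑ : ∀ N (Ψ : ℕ → Mono R m → Carrier) ss →
           ∑ₘ (λ s → ∑[ k < N ] Ψ k s) ss ≈ ∑[ k < N ] ∑ₘ (Ψ k) ss
    ∑ₘ-∑ N Ψ []       = sym (∑-zero N (λ _ _ → refl))
    ∑ₘ-∑ N Ψ (s ∷ ss) = trans (+-congˡ (∑ₘ-∑ N Ψ ss)) (sym (∑-distrib-+ N _ _))

    ∑ₘ-× : ∀ n (ψ : Mono R m → Carrier) ss → ∑ₘ (λ s → n ·ₙ ψ s) ss ≈ n ·ₙ ∑ₘ ψ ss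
    ∑ₘ-× n ψ []       = sym (×-zeroʳ n)
    ∑ₘ-× n ψ (s ∷ ss) = trans (+-congˡ (∑ₘ-× n ψ ss)) (sym (×-distrib-+ _ _ n))

    ∑ₘ-*ˡ : ∀ x (ψ : Mono R m → Carrier) ss → ∑ₘ (λ s → x * ψ s) ss ≈ x * ∑ₘ ψ ss
    ∑ₘ-*ˡ x ψ []       = sym (zeroʳ x)
    ∑ₘ-*ˡ x ψ (s ∷ ss) = trans (+-congˡ (∑ₘ-*ˡ x ψ ss)) (sym (distribˡ x _ _))

    ∑ₘ-∑C : ∀ d (Ψ : ℕ → ℕ → Mono R m → Carrier) ss →
            ∑ₘ (λ s → ∑C d (λ i j → Ψ i j s)) ss ≈ ∑C d (λ i j → ∑ₘ (Ψ i j) ss)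
    ∑ₘ-∑C d Ψ ss = trans (∑ₘ-∑ (suc d) _ ss) (∑-cong (suc d) (λ i → ∑ₘ-× (d C i) (Ψ i (d ∸ i)) ss))

  ∑ₘ-cong-degX : ∀ {m} (e : UExpr R m) {ψ χ : Mono R m → Carrier} →
                 (∀ s → deg s ≤ degX e → ψ s ≈ χ s) → ∑ₘ ψ (expand R e) ≈ ∑ₘ χ (expand R e)
  ∑ₘ-cong-degX e ψ≈χ = go (expand-degX e)
    where
    go : ∀ {ss} → All (λ s → deg s ≤ degX e) ss → ∑ₘ _ ss ≈ ∑ₘ _ ss
    go []               = refl
    go {s ∷ _} (d≤ ∷ ds) = +-cong (ψ≈χ s d≤) (go ds)

  -- Pulls a functional on monomials back along translate, expanding (x + u₀)ᵈ binomially.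
  translate* : ∀ {m} → (Mono R (suc m) → Carrier) → Mono R m → Carrier
  translate* ψ (r , d , v) = ∑C d (λ i j → ψ (r , i , j ∷ᵥ v))

  -- Exponent vectors are functions, so they are only equal pointwise.
  Extensional : ∀ {m} → (Mono R m → Carrier) → Set (c ⊔ˡ ℓ)
  Extensional ψ = ∀ {r d v w} → (∀ i → v i ≡ w i) → ψ (r , d , v) ≈ ψ (r , d , w)

  translate*-constant : ∀ {m} (ψ : Mono R (suc m) → Carrier) r v → translate* ψ (r , 0 , v) ≈ ψ (r , 0 , 0 ∷ᵥ v)
  translate*-constant ψ r v = trans (+-identityˡ _) (×-homo-1 _)

  mulMono-extensional : ∀ {m} {ψ : Mono R m → Carrier} → Extensional ψ → ∀ s → Extensional (ψ ∘ mulMono R s)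
  mulMono-extensional ext (r , d , v) v≗w = ext (λ i → ≡.cong (v i ℕ.+_) (v≗w i))

  translate*-mulMono : ∀ {m} {ψ : Mono R (suc m) → Carrier} → Extensional ψ → ∀ s ss →
    translate* (λ s′ → ∑ₘ (translate* (ψ ∘ mulMono R s′)) ss) s ≈ ∑ₘ (translate* ψ ∘ mulMono R s) ss
  translate*-mulMono {ψ = ψ} ext (r , d , v) ss = begin
    ∑C d (λ i j → ∑ₘ (translate* (ψ ∘ mulMono R (r , i , j ∷ᵥ v))) ss)
      ≈⟨ ∑ₘ-∑C d (λ i j → translate* (ψ ∘ mulMono R (r , i , j ∷ᵥ v))) ss ⟨
    ∑ₘ (λ s′ → ∑C d (λ i j → translate* (ψ ∘ mulMono R (r , i , j ∷ᵥ v)) s′)) ss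
      ≈⟨ ∑ₘ-cong (λ { (r′ , e , w) → vandermonde r′ e w }) ss ⟩
    ∑ₘ (translate* ψ ∘ mulMono R (r , d , v)) ss
      ∎
    where
    vandermonde : ∀ r′ e w → ∑C d (λ i j → translate* (ψ ∘ mulMono R (r , i , j ∷ᵥ v)) (r′ , e , w))
                             ≈ translate* ψ (r * r′ , d ℕ.+ e , λ k → v k ℕ.+ w k)
    vandermonde r′ e w = trans
      (∑C-cong d {λ i j → translate* (ψ ∘ mulMono R (r , i , j ∷ᵥ v)) (r′ , e , w)}
                 {λ i j → ∑C e (λ i′ j′ → G (i ℕ.+ i′) (j ℕ.+ j′))}
                 (λ i j _ → ∑C-cong e {λ i′ j′ → ψ (r * r′ , i ℕ.+ i′ , λ k → (j ∷ᵥ v) k ℕ.+ (j′ ∷ᵥ w) k)}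
                                      {λ i′ j′ → G (i ℕ.+ i′) (j ℕ.+ j′)}
                                      (λ i′ j′ _ → ext (λ { Fin.zero → ≡.refl ; (Fin.suc _) → ≡.refl }))))
      (∑C-vandermonde d e G)
      where
      G : ℕ → ℕ → Carrier
      G t u = ψ (r * r′ , t , u ∷ᵥ (λ k → v k ℕ.+ w k))

  ∑ₘ-translate : ∀ {m} (e : UExpr R m) {ψ : Mono R (suc m) → Carrier} → Extensional ψ →
                 ∑ₘ ψ (expand R (translate e)) ≈ ∑ₘ (translate* ψ) (expand R e)
  ∑ₘ-translate X       {ψ} ext = begin
    ∑ₘ ψ (expand R (X ⊕ U Fin.zero))
      ≈⟨ +-cong (ext (λ { Fin.zero → ≡.refl ; (Fin.suc _) → ≡.refl }))
                (trans (+-identityʳ _) (ext (λ { Fin.zero → ≡.refl ; (Fin.suc _) → ≡.refl }))) ⟩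
    ψ (1# , 1 , 0 ∷ᵥ (λ _ → 0)) + ψ (1# , 0 , 1 ∷ᵥ (λ _ → 0))
      ≈⟨ +-comm _ _ ⟩
    ψ (1# , 0 , 1 ∷ᵥ (λ _ → 0)) + ψ (1# , 1 , 0 ∷ᵥ (λ _ → 0))
      ≈⟨ trans (+-identityʳ _) (+-cong (trans (+-identityˡ _) (×-homo-1 _)) (×-homo-1 _)) ⟨
    translate* ψ (1# , 1 , λ _ → 0) + 0#
      ∎
  ∑ₘ-translate (U i) {ψ} ext = +-congʳ (sym (trans (translate*-constant ψ 1# _)
                                                   (ext (λ { Fin.zero → ≡.refl ; (Fin.suc _) → ≡.refl }))))
  ∑ₘ-translate (K r) {ψ} ext = +-congʳ (sym (trans (translate*-constant ψ r (λ _ → 0))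
                                                   (ext (λ { Fin.zero → ≡.refl ; (Fin.suc _) → ≡.refl }))))
  ∑ₘ-translate (e ⊕ f) {ψ} ext = trans (∑ₘ-++ ψ (expand R (translate e)) _)
    (trans (+-cong (∑ₘ-translate e ext) (∑ₘ-translate f ext)) (sym (∑ₘ-++ (translate* ψ) (expand R e) _)))
  ∑ₘ-translate {m} (e ⊗ f) {ψ} ext = begin
    ∑ₘ ψ (expand R (translate e ⊗ translate f))
      ≈⟨ ∑ₘ-⊗ ψ (translate e) (translate f) ⟩
    ∑ₘ (λ s → ∑ₘ (ψ ∘ mulMono R s) (expand R (translate f))) (expand R (translate e))
      ≈⟨ ∑ₘ-cong (λ s → ∑ₘ-translate f {ψ ∘ mulMono R s} (mulMono-extensional {ψ = ψ} ext s))
                 (expand R (translate e)) ⟩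
    ∑ₘ Φ (expand R (translate e))
      ≈⟨ ∑ₘ-translate e {Φ} Φ-extensional ⟩
    ∑ₘ (translate* Φ) (expand R e)
      ≈⟨ ∑ₘ-cong (λ s → translate*-mulMono {ψ = ψ} ext s (expand R f)) (expand R e) ⟩
    ∑ₘ (λ s → ∑ₘ (translate* ψ ∘ mulMono R s) (expand R f)) (expand R e)
      ≈⟨ ∑ₘ-⊗ (translate* ψ) e f ⟨
    ∑ₘ (translate* ψ) (expand R (e ⊗ f))
      ∎
    where
    Φ : Mono R (suc m) → Carrier
    Φ s = ∑ₘ (translate* (ψ ∘ mulMono R s)) (expand R f)
    Φ-extensional : Extensional Φ
    Φ-extensional {r} {d} {v} {w} v≗w = ∑ₘ-cong (λ { (r′ , e′ , w′) →
      ∑C-cong e′ {λ i j → ψ (r * r′ , d ℕ.+ i , λ k → v k ℕ.+ (j ∷ᵥ w′) k)}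
                 {λ i j → ψ (r * r′ , d ℕ.+ i , λ k → w k ℕ.+ (j ∷ᵥ w′) k)}
                 (λ i j _ → ext (λ k → ≡.cong (ℕ._+ (j ∷ᵥ w′) k) (v≗w k))) }) (expand R f)
  module _ (a : ℕ → Carrier) where

    coeffE-diagonal : ∀ {m} r d (v : Fin m → ℕ) → coeffE a d (r , d , v) ≈ r * ∏Fin R m (λ i → a (v i))
    coeffE-diagonal r d v rewrite ≡ᵇ-refl d = refl

    coeffE-off : ∀ {m k} r d (v : Fin m → ℕ) → d ≢ k → coeffE a k (r , d , v) ≈ 0#
    coeffE-off r d v d≢k rewrite ≡ᵇ-≢ d≢k = refl

    coeffE-extensional : ∀ {m} k → Extensional (coeffE {m} a k)
    coeffE-extensional {m} k {r} {d} v≗w with d ≡ᵇ k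
    ... | true  = *-congˡ (∏Fin-cong m (λ i → ≡⇒≈ (≡.cong a (v≗w i))))
      where
      ∏Fin-cong : ∀ n {f g : Fin n → Carrier} → (∀ i → f i ≈ g i) → ∏Fin R n f ≈ ∏Fin R n g
      ∏Fin-cong zero    f≈g = refl
      ∏Fin-cong (suc n) f≈g = *-cong (f≈g Fin.zero) (∏Fin-cong n (f≈g ∘ Fin.suc))
    ... | false = refl

    coeffE-x* : ∀ {m} j (s : Mono R m) → coeffE a (suc j) (mulMono R (1# , 1 , λ _ → 0) s) ≈ coeffE a j s
    coeffE-x* j (r , d , v) with d ≡ᵇ j
    ... | true  = *-congʳ (*-identityˡ r)
    ... | false = refl

    translate*-coeffE : ∀ {m} j n (s : Mono R m) → deg s ≤ n →
      translate* (coeffE a j) s ≈ ∑[ k < suc n ] (((j ℕ.+ k) C j) ·ₙ (a k * coeffE a (j ℕ.+ k) s))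
    translate*-coeffE {m} j n (r , d , v) d≤n with j ℕ.≤? d
    ... | yes j≤d = begin
      ∑[ i < suc d ] ((d C i) ·ₙ coeffE a j (r , i , (d ∸ i) ∷ᵥ v))
        ≈⟨ ∑-single (suc d) j (s≤s j≤d) (λ i _ i≢j → ×-zero (d C i) (coeffE-off r i ((d ∸ i) ∷ᵥ v) i≢j)) ⟩
      (d C j) ·ₙ coeffE a j (r , j , k₀ ∷ᵥ v)
        ≈⟨ ×-congʳ (d C j) (trans (coeffE-diagonal r j (k₀ ∷ᵥ v)) (x*yz≈y*xz r (a k₀) P)) ⟩
      (d C j) ·ₙ (a k₀ * (r * P))
        ≈⟨ ≡⇒≈ (≡.cong (λ t → (t C j) ·ₙ (a k₀ * (r * P))) (≡.sym j+k₀≡d)) ⟩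
      ((j ℕ.+ k₀) C j) ·ₙ (a k₀ * (r * P))
        ≈⟨ ×-congʳ ((j ℕ.+ k₀) C j) (*-congˡ (trans (sym (coeffE-diagonal r d v))
                                                    (≡⇒≈ (≡.cong (λ t → coeffE a t (r , d , v)) (≡.sym j+k₀≡d))))) ⟩
      ((j ℕ.+ k₀) C j) ·ₙ (a k₀ * coeffE a (j ℕ.+ k₀) (r , d , v))
        ≈⟨ ∑-single (suc n) k₀ (s≤s (ℕ.≤-trans (ℕ.m∸n≤m d j) d≤n)) (λ k _ k≢k₀ →
             ×-*-zeroʳ ((j ℕ.+ k) C j) (a k) (coeffE-off r d v (λ d≡j+k → k≢k₀ (k≡k₀ d≡j+k)))) ⟨
      ∑[ k < suc n ] (((j ℕ.+ k) C j) ·ₙ (a k * coeffE a (j ℕ.+ k) (r , d , v)))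
        ∎
      where
      k₀ : ℕ
      k₀ = d ∸ j
      P : Carrier
      P = ∏Fin R m (λ i → a (v i))
      j+k₀≡d : j ℕ.+ k₀ ≡ d
      j+k₀≡d = ℕ.m+[n∸m]≡n j≤d
      k≡k₀ : ∀ {k} → d ≡ j ℕ.+ k → k ≡ k₀
      k≡k₀ {k} d≡j+k = ≡.trans (≡.sym (ℕ.m+n∸m≡n j k)) (≡.cong (_∸ j) (≡.sym d≡j+k))
    ... | no j≰d = trans
      (∑-zero (suc d) (λ i i<1+d → ×-zero (d C i)
         (coeffE-off r i ((d ∸ i) ∷ᵥ v) (λ i≡j → j≰d (≡.subst (_≤ d) i≡j (ℕ.≤-pred i<1+d))))))
      (sym (∑-zero (suc n) (λ k _ → ×-*-zeroʳ ((j ℕ.+ k) C j) (a k)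
             (coeffE-off r d v (λ d≡j+k → j≰d (≡.subst (j ≤_) (≡.sym d≡j+k) (ℕ.m≤m+n j k)))))))

    E-risingUmbral : ∀ n j → E R a (risingUmbral R n) j ≈ rising a n j
    E-risingUmbral zero    zero    = trans (+-identityʳ _) (*-identityˡ 1#)
    E-risingUmbral zero    (suc j) = +-identityʳ 0#
    E-risingUmbral (suc n) j       = begin
      ∑ₘ (coeffE a j) (expand R (risingUmbral R (suc n)))
        ≈⟨ ≡⇒≈ (≡.cong (λ e → ∑ₘ (coeffE a j) (expand R e)) (risingUmbral-suc n)) ⟩
      ∑ₘ (coeffE a j) (expand R (X ⊗ translate eₙ))
        ≈⟨ trans (∑ₘ-⊗ (coeffE a j) X (translate eₙ)) (+-identityʳ _) ⟩
      ∑ₘ (coeffE a j ∘ mulMono R (1# , 1 , λ _ → 0)) (expand R (translate eₙ))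
        ≈⟨ times-x j ⟩
      rising a (suc n) j
        ∎
      where
      eₙ : UExpr R n
      eₙ = risingUmbral R n
      times-x : ∀ j →
        ∑ₘ (coeffE a j ∘ mulMono R (1# , 1 , λ _ → 0)) (expand R (translate eₙ)) ≈ rising a (suc n) j
      times-x zero    = ∑ₘ-zero (λ _ → refl) (expand R (translate eₙ))
      times-x (suc j) = begin
        ∑ₘ (coeffE a (suc j) ∘ mulMono R (1# , 1 , λ _ → 0)) (expand R (translate eₙ))
          ≈⟨ ∑ₘ-cong (coeffE-x* j) (expand R (translate eₙ)) ⟩
        ∑ₘ (coeffE a j) (expand R (translate eₙ))
          -- η-expanded: unexpanded, Agda would have to solve for d through d ≡ᵇ j
          ≈⟨ ∑ₘ-translate eₙ {coeffE a j} (λ {r} {d} → coeffE-extensional j {r} {d}) ⟩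
        ∑ₘ (translate* (coeffE a j)) (expand R eₙ)
          ≈⟨ ∑ₘ-cong-degX eₙ (λ s d≤ → translate*-coeffE j n s (≡.subst (deg s ≤_) (degX-risingUmbral n) d≤)) ⟩
        ∑ₘ (λ s → ∑[ k < suc n ] (((j ℕ.+ k) C j) ·ₙ (a k * coeffE a (j ℕ.+ k) s))) (expand R eₙ)
          ≈⟨ ∑ₘ-∑ (suc n) (λ k s → ((j ℕ.+ k) C j) ·ₙ (a k * coeffE a (j ℕ.+ k) s)) (expand R eₙ) ⟩
        ∑[ k < suc n ] ∑ₘ (λ s → ((j ℕ.+ k) C j) ·ₙ (a k * coeffE a (j ℕ.+ k) s)) (expand R eₙ)
          ≈⟨ ∑-cong (suc n) (λ k → trans (∑ₘ-× ((j ℕ.+ k) C j) _ (expand R eₙ))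
               (×-congʳ ((j ℕ.+ k) C j) (trans (∑ₘ-*ˡ (a k) _ (expand R eₙ))
                                               (*-congˡ (E-risingUmbral n (j ℕ.+ k)))))) ⟩
        rising a (suc n) (suc j)
          ∎

  ×-cancelˡ-suc : Containsℚ R → ∀ n {x y} → suc n ·ₙ x ≈ suc n ·ₙ y → x ≈ y
  ×-cancelˡ-suc (f , monomorphism) n {x} {y} nx≈ny = begin
    x                    ≈⟨ *-identityˡ x ⟨
    1# * x               ≈⟨ *-congʳ inverse ⟨
    f (1/ q) * f q * x   ≈⟨ *-assoc _ _ x ⟩
    f (1/ q) * (f q * x) ≈⟨ *-congˡ (trans (scale x) (trans nx≈ny (sym (scale y)))) ⟩
    f (1/ q) * (f q * y) ≈⟨ *-assoc _ _ y ⟨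
    f (1/ q) * f q * y   ≈⟨ *-congʳ inverse ⟩
    1# * y               ≈⟨ *-identityˡ y ⟩
    y                    ∎
    where
    open RingMorphisms.IsRingMonomorphism monomorphism
    q : ℚ
    q = ℕ→ℚ (suc n)
    instance
      q≢0 : ℚ.NonZero q
      q≢0 = ℚ.pos⇒nonZero q {{ℕ→ℚ-suc-positive n}}
    f-ℕ→ℚ : ∀ k → f (ℕ→ℚ k) ≈ k ·ₙ 1#
    f-ℕ→ℚ zero    = 0#-homo
    f-ℕ→ℚ (suc k) = trans (+-homo 1ℚ (ℕ→ℚ k)) (+-cong 1#-homo (f-ℕ→ℚ k))
    scale : ∀ z → f q * z ≈ suc n ·ₙ z
    scale z = trans (*-congʳ (f-ℕ→ℚ (suc n))) (trans (×-assoc-* (suc n) 1# z) (×-congʳ (suc n) (*-identityˡ z)))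
    inverse : f (1/ q) * f q ≈ 1#
    inverse = trans (sym (*-homo (1/ q) q)) (trans (≡⇒≈ (≡.cong f (ℚ.*-inverseˡ q))) 1#-homo)

  -- The identity at x = 1 gives (j + 2) P n (j + 2) in terms of the columns 1 and j + 1.
  binomial-unique : Containsℚ R → ∀ {P Q} → BinomialIdentity P → BinomialIdentity Q →
    (∀ n → P n 0 ≈ Q n 0) → (∀ n → P n 1 ≈ Q n 1) → ∀ n j → P n j ≈ Q n j
  binomial-unique ℚ⊆R {P} {Q} P-binomial Q-binomial P≈Q₀ P≈Q₁ n zero    = P≈Q₀ n
  binomial-unique ℚ⊆R {P} {Q} P-binomial Q-binomial P≈Q₀ P≈Q₁ n (suc j) = column j n
    where
    column : ∀ j n → P n (suc j) ≈ Q n (suc j)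
    column zero    n = P≈Q₁ n
    column (suc j) n = ×-cancelˡ-suc ℚ⊆R (suc j) (begin
      suc (suc j) ·ₙ P n (suc (suc j))    ≈⟨ ×-congˡ (≡.sym (nC1≡n (suc (suc j)))) ⟩
      atSum (P n) 1 (suc j)               ≈⟨ P-binomial n 1 (suc j) ⟩
      ∑C n (λ i k → P i 1 * P k (suc j))  ≈⟨ ∑C-cong n (λ i k _ → *-cong (P≈Q₁ i) (column j k)) ⟩
      ∑C n (λ i k → Q i 1 * Q k (suc j))  ≈⟨ Q-binomial n 1 (suc j) ⟨
      atSum (Q n) 1 (suc j)               ≈⟨ ×-congˡ (nC1≡n (suc (suc j))) ⟩
      suc (suc j) ·ₙ Q n (suc (suc j))    ∎)

  module _ {P : ℕ → ℕ → Carrier} (P-binomial : BinomialIdentity P)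
           (P₀-constant : ∀ j → P 0 (suc j) ≈ 0#) (P₁₁≈1 : P 1 1 ≈ 1#) where

    binomial-P₀₀ : P 0 0 ≈ 1#
    binomial-P₀₀ = begin
      P 0 0               ≈⟨ trans (*-congʳ P₁₁≈1) (*-identityˡ _) ⟨
      P 1 1 * P 0 0       ≈⟨ trans (+-identityˡ _) (×-homo-1 _) ⟨
      0# + 1 ·ₙ (P 1 1 * P 0 0)
        ≈⟨ +-congʳ (trans (+-identityˡ _) (×-zero 1 (trans (*-congʳ (P₀-constant 0)) (zeroˡ (P 1 0))))) ⟨
      ∑C 1 (λ i j → P i 1 * P j 0) ≈⟨ P-binomial 1 1 0 ⟨
      1 ·ₙ P 1 1          ≈⟨ trans (×-homo-1 _) P₁₁≈1 ⟩
      1#                  ∎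

    -- At x = y = 0 the identity reads P (i+1) 0 = 2 P (i+1) 0 once P k 0 = 0 for 0 < k ≤ i.
    binomial-Pₛ₀ : ∀ n → P (suc n) 0 ≈ 0#
    binomial-Pₛ₀ n = vanishing (suc n) n ℕ.≤-refl
      where
      vanishing : ∀ N i → i < N → P (suc i) 0 ≈ 0#
      vanishing (suc N) i (s≤s i≤N) with i ℕ.≟ N
      ... | no i≢N     = vanishing N i (ℕ.≤∧≢⇒< i≤N i≢N)
      ... | yes ≡.refl = identityˡ-unique x x (sym (begin
        x                                                  ≈⟨ ×-homo-1 x ⟨
        atSum (P (suc N)) 0 0                              ≈⟨ P-binomial (suc N) 0 0 ⟩
        ∑C (suc N) (λ a b → P a 0 * P b 0)                 ≈⟨ ∑-head (suc N) _ ⟩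
        1 ·ₙ (P 0 0 * x) + (∑[ k < N ] g k + g N)          ≈⟨ +-cong first (+-cong middle last) ⟩
        x + (0# + x)                                       ≈⟨ +-congˡ (+-identityˡ x) ⟩
        x + x                                              ∎))
        where
        x : Carrier
        x = P (suc N) 0
        g : ℕ → Carrier
        g k = (suc N C suc k) ·ₙ (P (suc k) 0 * P (N ∸ k) 0)
        first : 1 ·ₙ (P 0 0 * x) ≈ x
        first = trans (×-homo-1 _) (trans (*-congʳ binomial-P₀₀) (*-identityˡ x))
        middle : ∑[ k < N ] g k ≈ 0#
        middle = ∑-zero N (λ k k<N → ×-zero (suc N C suc k)
                   (trans (*-congʳ (vanishing N k k<N)) (zeroˡ (P (N ∸ k) 0))))
        last : g N ≈ x
        last = trans (×-congˡ (nCn≡1 (suc N))) (trans (×-homo-1 _)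
                 (trans (*-congˡ (trans (≡⇒≈ (≡.cong (λ m → P m 0) (ℕ.n∸n≡0 N))) binomial-P₀₀)) (*-identityʳ x)))

  module _ (t : ℕ → Carrier) where

    -- approx n is correct at the indices ≤ n; the moment n + 1 is chosen so that the
    -- coefficient of x in pₙ₊₂ is t (n + 1).
    approx : ℕ → ℕ → Carrier
    approx zero    k = t 0
    approx (suc n) k =
      if k ≡ᵇ suc n then t (suc n) - translateE (approx n) n (rising (approx n) (suc n)) 0 else approx n k

    moments : ℕ → Carrier
    moments k = approx k k

    approx-stable : ∀ n k → k ≤ n → approx n k ≡ moments k
    approx-stable zero    zero z≤n   = ≡.refl
    approx-stable (suc n) k    k≤1+n with k ℕ.≟ suc n
    ... | yes ≡.refl = ≡.refl
    ... | no k≢1+n rewrite ≡ᵇ-≢ k≢1+n = approx-stable n k (ℕ.≤-pred (ℕ.≤∧≢⇒< k≤1+n k≢1+n))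

    rising-moments₁ : t 0 ≈ 1# → ∀ n → rising moments (suc n) 1 ≈ t n
    rising-moments₁ t₀≈1 zero    = trans (+-identityˡ _) (trans (×-homo-1 _) (*-identityʳ (t 0)))
    rising-moments₁ t₀≈1 (suc n) = begin
      translateE moments n (rising moments (suc n)) 0
        + (suc n C 0) ·ₙ (moments (suc n) * rising moments (suc n) (suc n))
        ≈⟨ +-cong lower≈ (trans (×-homo-1 _) (trans (*-congˡ (rising-diagonal moments t₀≈1 (suc n))) (*-identityʳ _))) ⟩
      lower + moments (suc n)
        ≈⟨ +-congˡ (≡⇒≈ moments-suc) ⟩
      lower + (t (suc n) - lower)
        ≈⟨ x+yz≈y+xz lower (t (suc n)) (- lower) ⟩
      t (suc n) + (lower - lower)
        ≈⟨ trans (+-congˡ (-‿inverseʳ lower)) (+-identityʳ _) ⟩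
      t (suc n)
        ∎
      where
      lower : Carrier
      lower = translateE (approx n) n (rising (approx n) (suc n)) 0
      approx≈moments : ∀ k → k < suc n → moments k ≈ approx n k
      approx≈moments k k<1+n = ≡⇒≈ (≡.sym (approx-stable n k (ℕ.≤-pred k<1+n)))
      lower≈ : translateE moments n (rising moments (suc n)) 0 ≈ lower
      lower≈ = ∑-cong-< (suc n) (λ k k<1+n → ×-congʳ (k C 0)
        (*-cong (approx≈moments k k<1+n) (rising-cong (suc n) approx≈moments k)))
      moments-suc : moments (suc n) ≡ t (suc n) - lower
      moments-suc rewrite ≡ᵇ-refl n = ≡.refl

  binomial⇒rising : Containsℚ R → ∀ {P} → BinomialIdentity P → (∀ j → P 0 (suc j) ≈ 0#) → P 1 1 ≈ 1# →
    ∀ n j → rising (moments (λ n → P (suc n) 1)) n j ≈ P n j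
  binomial⇒rising ℚ⊆R {P} P-binomial P₀-constant P₁₁≈1 =
    binomial-unique ℚ⊆R (rising-binomial a) P-binomial column₀ column₁
    where
    a : ℕ → Carrier
    a = moments (λ n → P (suc n) 1)
    column₀ : ∀ n → rising a n 0 ≈ P n 0
    column₀ zero    = sym (binomial-P₀₀ P-binomial P₀-constant P₁₁≈1)
    column₀ (suc n) = sym (binomial-Pₛ₀ P-binomial P₀-constant P₁₁≈1 n)
    column₁ : ∀ n → rising a n 1 ≈ P n 1
    column₁ zero    = sym (P₀-constant 0)
    column₁ (suc n) = rising-moments₁ (λ n → P (suc n) 1) P₁₁≈1 n

theorem5p8 : ∀ {c ℓ} (R : CommutativeRing c ℓ) → Containsℚ R →
    let open CommutativeRing R in
    (p : ℕ → Poly R) →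
    (∀ n → HasDegree R n (p n)) →
    _≈P_ R (p 1) (Xpoly R) →
    (BinomialType R p ⇔
      Σ (ℕ → Carrier) (λ a → (a 0 ≈ 1#) ×
        (∀ n → ∀ j → E R a (risingUmbral R n) j ≈ coeff R (p n) j)))
theorem5p8 R ℚ⊆R p p-degree p₁≈x = mk⇔
  (λ binomial → a , p₁≈x 1 , λ n j →
     trans (E-risingUmbral R a n j) (binomial⇒rising R ℚ⊆R (to binomial) p₀-constant (p₁≈x 1) n j))
  (λ { (a′ , _ , E≈p) → from (BinomialIdentity-cong R (λ n j → trans (sym (E-risingUmbral R a′ n j)) (E≈p n j))
                                                     (rising-binomial R a′)) })
  where
  open CommutativeRing R using (Carrier; _≈_; 0#; trans; sym)
  open Equivalence (binomialType⇔binomialIdentity R p)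
  a : ℕ → Carrier
  a = moments R (λ n → coeff R (p (suc n)) 1)
  p₀-constant : ∀ j → coeff R (p 0) (suc j) ≈ 0#
  p₀-constant j = proj₁ (p-degree 0) (suc j) (s≤s z≤n)
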